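{- Consider one pass of StreamingLocalSearch$(\alpha,\beta,S_{\mathrm{init}})$ performed within MultipassLocalSearch (so $S_{\mathrm{init}}$ is either $\emptyset$ or the output of the previous pass), and let $\prec$ be the pretend order and $\nu$ the incremental values of this pass. Then for any $T\subseteq U\subseteq X$: (1) $\sum_{e\in T}\nu(e,T)=f(T)-f(\emptyset)$; (2) $\nu(e,U)\le\nu(e,T)$ for all $e\in T$; (3) $f(T\mid U\setminus T)\le\sum_{t\in T}\nu(t,U)$; (4) at all times during the execution of StreamingLocalSearch, $\nu(e,S)\ge\alpha$ for every $e$ in the current solution $S$.
   Context: $X$ is a finite ground set and $f:2^X\to\mathbb{R}_{\ge 0}$ is submodular, i.e. $f(A)+f(B)\ge f(A\cup B)+f(A\cap B)$ for all $A,B\subseteq X$. For $e\in X$ and $A,T,U\subseteq X$ write $f(e\mid A)=f(A\cup\{e\})-f(A)$ and $f(T\mid U)=f(T\cup U)-f(U)$. A $p$-matchoid on $X$ is a collection of matroids $\mathcal{M}_\ell=(X_\ell,\mathcal{I}_\ell)$, $X_\ell\subseteq X$, such that every element of $X$ lies in at most $p$ of the sets $X_\ell$; a set $S\subseteq X$ is feasible, written $S\in\mathcal{I}$, iff $S\cap X_\ell\in\mathcal{I}_\ell$ for all $\ell$. The elements of $X$ arrive one at a time in a stream; in a multi-pass algorithm every pass receives all of $X$. Incremental values: given a total order $\prec$ on $X$, for $e\in X$, $T\subseteq X$ let $\nu(e,T)=f(e\mid\{t\in T:t\prec e\})$. Exchange$(x,S)$: start with $C_x=\emptyset$; for each $\mathcal{M}_\ell$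 with $x\in X_\ell$, let $S_\ell=S\cap X_\ell$; if $S_\ell\cup\{x\}\notin\mathcal{I}_\ell$, let $T_\ell=\{y\in S_\ell:(S_\ell\setminus\{y\})\cup\{x\}\in\mathcal{I}_\ell\}$ and add to $C_x$ an element of $T_\ell$ minimizing $\nu(\cdot,S)$. Return $C_x$. StreamingLocalSearch$(\alpha,\beta,S_{\mathrm{init}})$, with parameters $\alpha\ge0$, $\beta>0$: set $S\leftarrow S_{\mathrm{init}}$; for each arriving $x$: if $x\in S_{\mathrm{init}}$ discard it; otherwise compute $C_x=$ Exchange$(x,S)$ and, if $f(x\mid S)\ge\alpha+(1+\beta)\sum_{c\in C_x}\nu(c,S)$, set $S\leftarrow(S\setminus C_x)\cup\{x\}$ ($x$ is accepted, elements of $C_x$ are evicted); otherwise $x$ is rejected. Output final $S$. The order $\prec$ used for $\nu$ in a pass is the pretend order: first the elements of $S_{\mathrm{init}}$ in the same relative order as in the pretend order of the pass that produced $S_{\mathrm{init}}$, then the elements of $X\setminus S_{\mathrm{init}}$ in arrival order. MultipassLocalSearch$(\alpha,\beta_1,\dots,\beta_d)$: $S_0=\emptyset$, and for $i=1,\dots,d$, $S_i$ is the output of StreamingLocalSearch$(\alpha,\beta_i,S_{i-1})$ run on a new pass over the stream. -}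

module Defs where

open import Level using (0ℓ)
open import Data.Nat as ℕ using (ℕ; suc)
open import Data.Bool using (Bool; true; false; if_then_else_)
open import Data.Fin using (Fin; _≟_)
open import Data.Fin.Subset public
  using (Subset; _∈_; _∉_; _⊆_; _∪_; _∩_; _─_; ⁅_⁆; ∣_∣)
  renaming (⊥ to ∅)
open import Data.Fin.Subset.Properties using (_∈?_)
open import Data.List as List using (List; []; _∷_; _++_; filter; takeWhile; foldr; allFin; length)
open import Data.List.Relation.Unary.Unique.Propositional using (Unique)
import Data.List.Membership.Propositional as LMem
open import Data.Vec using (lookup)
open import Data.Maybe using (Maybe; just; nothing)
open import Data.Product using (Σ; ∃; _×_; _,_)
open import Function.Bundles using (_⇔_)
open import Relation.Nullary using (¬_; ¬?)
open import Relation.Binary using (Rel; IsTotalOrder)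
open import Relation.Binary.PropositionalEquality using (_≡_; _≢_)
open import Algebra.Core using (Op₁; Op₂)
open import Algebra.Structures using (IsCommutativeRing)

-- Values: an arbitrary (totally) ordered commutative ring.  The real
-- numbers are an instance; the statement is proved for all of them.

record OrderedCommRing : Set₁ where
  infixl 7 _*_
  infixl 6 _+_ _-_
  infix 4 _≤_ _<_
  field
    Carrier : Set
    _+_ _*_ : Op₂ Carrier
    -_      : Op₁ Carrier
    0# 1#   : Carrier
    _≤_     : Rel Carrier 0ℓ
    isCommutativeRing : IsCommutativeRing _≡_ _+_ _*_ -_ 0# 1#
    isTotalOrder      : IsTotalOrder _≡_ _≤_
    +-monoˡ-≤ : ∀ {x y} z → x ≤ y → x + z ≤ y + z
    *-nonneg  : ∀ {x y} → 0# ≤ x → 0# ≤ y → 0# ≤ x * y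

  _-_ : Op₂ Carrier
  x - y = x + (- y)

  _<_ : Rel Carrier 0ℓ
  x < y = (x ≤ y) × (x ≢ y)

record Matroid (n : ℕ) : Set₁ where
  field
    ground      : Subset n
    Indep       : Subset n → Set
    indep⊆      : ∀ {I} → Indep I → I ⊆ ground
    indep-∅     : Indep ∅
    indep-hered : ∀ {I J} → J ⊆ I → Indep I → Indep J
    indep-aug   : ∀ {I J} → Indep I → Indep J → ∣ I ∣ ℕ.< ∣ J ∣ →
                  ∃ λ x → x ∈ J × x ∉ I × Indep (I ∪ ⁅ x ⁆)

occurrences : ∀ {n m} → (Fin m → Matroid n) → Fin n → ℕ
occurrences {m = m} M x =
  length (filter (λ ℓ → x ∈? Matroid.ground (M ℓ)) (allFin m))

record Matchoid (n p : ℕ) : Set₁ where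
  field
    m        : ℕ
    matroid  : Fin m → Matroid n
    p-bound  : ∀ x → occurrences matroid x ℕ.≤ p

IsStream : ∀ {n} → List (Fin n) → Set
IsStream {n} σ = Unique σ × (∀ (x : Fin n) → x LMem.∈ σ)

module _ (R : OrderedCommRing) where
  open OrderedCommRing R

  sumOver : ∀ {n} → Subset n → (Fin n → Carrier) → Carrier
  sumOver {n} T g = foldr (λ e acc → (if lookup T e then g e else 0#) + acc) 0# (allFin n)

  Submodular : ∀ {n} → (Subset n → Carrier) → Set
  Submodular f = ∀ A B → f (A ∪ B) + f (A ∩ B) ≤ f A + f B

  NonNegative : ∀ {n} → (Subset n → Carrier) → Set
  NonNegative f = ∀ A → 0# ≤ f A

  marg : ∀ {n} → (Subset n → Carrier) → Subset n → Subset n → Carrier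
  marg f T U = f (T ∪ U) - f U

  setOf : ∀ {n} → List (Fin n) → Subset n
  setOf = foldr (λ y s → ⁅ y ⁆ ∪ s) ∅

  before : ∀ {n} → List (Fin n) → Fin n → Subset n
  before π e = setOf (takeWhile (λ y → ¬? (y ≟ e)) π)

  ν : ∀ {n} → (Subset n → Carrier) → List (Fin n) → Fin n → Subset n → Carrier
  ν f π e T = marg f ⁅ e ⁆ (T ∩ before π e)

  -- pretend order of a pass with initial solution S₀, where πprev is the
  -- pretend order of the pass that produced S₀, and σ the arrival order
  pretend : ∀ {n} → Subset n → List (Fin n) → List (Fin n) → List (Fin n)
  pretend S₀ πprev σ = filter (_∈? S₀) πprev ++ filter (λ x → ¬? (x ∈? S₀)) σ

  module _ {n p : ℕ} (f : Subset n → Carrier) (𝓜 : Matchoid n p) where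
    open Matchoid 𝓜
    open Matroid

    Conflict : Fin m → Fin n → Subset n → Set
    Conflict ℓ x S = x ∈ ground (matroid ℓ) ×
      ¬ Indep (matroid ℓ) ((S ∩ ground (matroid ℓ)) ∪ ⁅ x ⁆)

    Swappable : Fin m → Fin n → Subset n → Fin n → Set
    Swappable ℓ x S y = y ∈ (S ∩ ground (matroid ℓ)) ×
      Indep (matroid ℓ) (((S ∩ ground (matroid ℓ)) ─ ⁅ y ⁆) ∪ ⁅ x ⁆)

    -- C is a possible output of Exchange(x,S) (ties in the argmin broken
    -- arbitrarily), the pretend order being π
    record IsExchange (π : List (Fin n)) (x : Fin n) (S C : Subset n) : Set where
      field
        pick         : Fin m → Maybe (Fin n)
        pick-nothing : ∀ ℓ → pick ℓ ≡ nothing → ¬ Conflict ℓ x S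
        pick-just    : ∀ ℓ y → pick ℓ ≡ just y →
                       Conflict ℓ x S × Swappable ℓ x S y ×
                       (∀ z → Swappable ℓ x S z → ν f π y S ≤ ν f π z S)
        C-spec       : ∀ e → (e ∈ C) ⇔ (∃ λ ℓ → pick ℓ ≡ just e)

    module _ (α β : Carrier) (S₀ : Subset n) (π : List (Fin n)) where

      data Step (x : Fin n) (S : Subset n) : Subset n → Set where
        discard : x ∈ S₀ → Step x S S
        accept  : ∀ {C} → x ∉ S₀ → IsExchange π x S C →
                  α + (1# + β) * sumOver C (λ c → ν f π c S) ≤ marg f ⁅ x ⁆ S →
                  Step x S ((S ─ C) ∪ ⁅ x ⁆)
        reject  : ∀ {C} → x ∉ S₀ → IsExchange π x S C →
                  ¬ (α + (1# + β) * sumOver C (λ c → ν f π c S) ≤ marg f ⁅ x ⁆ S) →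
                  Step x S S

      -- Trace σ rest S : after processing the part of the stream σ before
      -- 'rest', the current solution is S.
      data Trace (σ : List (Fin n)) : List (Fin n) → Subset n → Set where
        start : Trace σ σ S₀
        step  : ∀ {x xs S S'} → Trace σ (x ∷ xs) S → Step x S S' → Trace σ xs S'

    -- MultipassState α β σ i S π : after i passes of
    -- MultipassLocalSearch(α,β₁,β₂,…) (pass j+1 uses β j and stream σ j),
    -- the solution is S = S_i and the pretend order of pass i is π.
    data MultipassState (α : Carrier) (β : ℕ → Carrier) (σ : ℕ → List (Fin n))
         : ℕ → Subset n → List (Fin n) → Set where
      init : MultipassState α β σ 0 ∅ []
      next : ∀ {i S π S'} → MultipassState α β σ i S π →
             Trace α (β i) S (pretend S π (σ i)) (σ i) [] S' →
             MultipassState α β σ (suc i) S' (pretend S π (σ i))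

-- Along a fixed total order, ν(e,T) is the gain of e over the elements of T preceding
-- it, so summing these gains over T telescopes: with base set ∅ this is (1), and with
-- base set U ∖ T it gives (3) after comparing each gain with ν(t,U) by diminishing
-- returns, which is also (2).
-- For (4), everything in the current solution precedes the arriving element x in the
-- pretend order (it lies in S_init, which comes first, or arrived earlier). So an
-- accepted x is last: the values of the kept elements can only grow, and
-- ν(x,S') ≥ f(x | S) ≥ α by the acceptance test. On S_init the pretend order agrees
-- with that of the previous pass, which carries the invariant from pass to pass.

module Submission where

open import Defs
open import Data.Nat using (ℕ; _<_)
open import Data.Fin using (Fin)
open import Data.List using (List)
open import Data.Product using (_×_)
open import Relation.Binary.PropositionalEquality using (_≡_)

open import Level using (0ℓ)
open import Data.Nat using (suc)
open import Data.Nat.Properties using (m<n⇒m<1+n; n<1+n; <-trans)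
open import Algebra.Bundles using (CommutativeRing)
open import Algebra.Structures using (IsCommutativeRing)
open import Data.Bool using (true; false; if_then_else_; _∨_)
open import Data.Bool.Properties using (∨-identityʳ)
open import Data.Empty using (⊥-elim)
open import Data.Fin using (_≟_) renaming (zero to fzero; suc to fsuc)
open import Data.Fin.Subset.Properties
  using (_∈?_; ⊆-antisym; ∉⊥; x∈⁅x⁆; x∈⁅y⁆⇒x≡y; x∈p∩q⁺; x∈p∩q⁻; x∈p∪q⁺; x∈p∪q⁻;
         ∪-assoc; ∪-comm; ∪-identityˡ; ∪-identityʳ; ∩-comm; ∩-zeroʳ; ∩-distribˡ-∪; ∩-distribʳ-∪;
         x∈p∧x∉q⇒x∈p─q; p─q⊆p)
open import Data.List using ([]; _∷_; _++_; _∷ʳ_; filter; takeWhile; foldr; map; tabulate; allFin)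
open import Data.List.Properties using (foldr-map; map-tabulate; filter-accept; filter-reject; filter-++; ++-identityʳ; ++-assoc)
open import Data.List.Membership.Propositional using () renaming (_∈_ to _∈ₗ_; _∉_ to _∉ₗ_)
open import Data.List.Membership.Propositional.Properties using (∈-++⁺ˡ; ∈-++⁺ʳ; ∈-++⁻; ∈-filter⁺; ∈-filter⁻)
open import Data.List.Relation.Unary.All as All using ()
open import Data.List.Relation.Unary.AllPairs using ([]; _∷_)
open import Data.List.Relation.Unary.Any using (here; there)
open import Data.List.Relation.Unary.Unique.Propositional using (Unique)
import Data.List.Relation.Unary.Unique.Propositional.Properties as Unique
open import Data.Product using (_,_; proj₁; proj₂)
open import Data.Sum using (inj₁; inj₂; [_,_])
open import Data.Vec using ([]; _∷_; lookup; _[_]=_)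
open _[_]=_
open import Function using (_∘_; id)
open import Function.Bundles using (Equivalence)
open import Relation.Binary using (IsTotalOrder; Poset)
open import Relation.Binary.PropositionalEquality using (refl; sym; trans; cong; cong₂; subst; subst₂; module ≡-Reasoning)
open import Relation.Nullary using (¬?; yes; no)
open import Relation.Unary using (Pred; Decidable)
import Relation.Binary.Reasoning.PartialOrder as PosetReasoning

module OrderedCommRingProperties (R : OrderedCommRing) where
  open OrderedCommRing R renaming (_<_ to _<ᴿ_)
  open IsCommutativeRing isCommutativeRing
    using (+-comm; +-identityˡ; +-identityʳ; -‿inverseʳ)
  open IsTotalOrder isTotalOrder using (total)
  open IsTotalOrder isTotalOrder public
    using () renaming (refl to ≤-refl; reflexive to ≤-reflexive; trans to ≤-trans; antisym to ≤-antisym)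

  commutativeRing : CommutativeRing 0ℓ 0ℓ
  commutativeRing = record { isCommutativeRing = isCommutativeRing }

  poset : Poset 0ℓ 0ℓ 0ℓ
  poset = record { isPartialOrder = IsTotalOrder.isPartialOrder isTotalOrder }

  open import Algebra.Properties.CommutativeSemigroup
    (CommutativeRing.+-commutativeSemigroup commutativeRing) using (interchange)
  open import Algebra.Properties.Ring (CommutativeRing.ring commutativeRing) using (-1*x≈-x; -‿involutive)
  module ≤-Reasoning = PosetReasoning poset

  +-mono-≤ : ∀ {a b c d} → a ≤ b → c ≤ d → a + c ≤ b + d
  +-mono-≤ {a} {b} {c} {d} a≤b c≤d = begin
    a + c ≤⟨ +-monoˡ-≤ c a≤b ⟩
    b + c ≡⟨ +-comm b c ⟩
    c + b ≤⟨ +-monoˡ-≤ b c≤d ⟩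
    d + b ≡⟨ +-comm d b ⟩
    b + d ∎
    where open ≤-Reasoning

  x≤x+y : ∀ {x y} → 0# ≤ y → x ≤ x + y
  x≤x+y {x} {y} 0≤y = begin
    x      ≡⟨ sym (+-identityˡ x) ⟩
    0# + x ≤⟨ +-monoˡ-≤ x 0≤y ⟩
    y + x  ≡⟨ +-comm y x ⟩
    x + y  ∎
    where open ≤-Reasoning

  -- If 1 ≤ 0 then 0 ≤ -1, hence 0 ≤ (-1)(-1) = 1.
  0≤1 : 0# ≤ 1#
  0≤1 with total 0# 1#
  ... | inj₁ 0≤1 = 0≤1
  ... | inj₂ 1≤0 = begin
    0#            ≤⟨ *-nonneg 0≤-1 0≤-1 ⟩
    - 1# * - 1#   ≡⟨ -1*x≈-x (- 1#) ⟩
    - - 1#        ≡⟨ -‿involutive 1# ⟩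
    1#            ∎
    where
    open ≤-Reasoning
    0≤-1 : 0# ≤ - 1#
    0≤-1 = begin
      0#          ≡⟨ sym (-‿inverseʳ 1#) ⟩
      1# + - 1#   ≤⟨ +-monoˡ-≤ (- 1#) 1≤0 ⟩
      0# + - 1#   ≡⟨ +-identityˡ (- 1#) ⟩
      - 1#        ∎

  0<x⇒0≤1+x : ∀ {x} → 0# <ᴿ x → 0# ≤ 1# + x
  0<x⇒0≤1+x {x} (0≤x , _) = begin
    0#      ≡⟨ sym (+-identityˡ 0#) ⟩
    0# + 0# ≤⟨ +-mono-≤ 0≤1 0≤x ⟩
    1# + x  ∎
    where open ≤-Reasoning

  [a-b]+[c-a]≡c-b : ∀ a b c → (a - b) + (c - a) ≡ c - b
  [a-b]+[c-a]≡c-b a b c = begin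
    (a - b) + (c - a)     ≡⟨ cong ((a - b) +_) (+-comm c (- a)) ⟩
    (a - b) + (- a + c)   ≡⟨ interchange a (- b) (- a) c ⟩
    (a - a) + (- b + c)   ≡⟨ cong (_+ (- b + c)) (-‿inverseʳ a) ⟩
    0# + (- b + c)        ≡⟨ +-identityˡ (- b + c) ⟩
    - b + c               ≡⟨ +-comm (- b) c ⟩
    c - b                 ∎
    where open ≡-Reasoning

  a+b≤c+d⇒a-d≤c-b : ∀ {a b c d} → a + b ≤ c + d → a - d ≤ c - b
  a+b≤c+d⇒a-d≤c-b {a} {b} {c} {d} a+b≤c+d = begin
    a - d                   ≡⟨ sym (+-identityʳ (a - d)) ⟩
    (a - d) + 0#            ≡⟨ cong ((a - d) +_) (sym (-‿inverseʳ b)) ⟩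
    (a - d) + (b - b)       ≡⟨ interchange a (- d) b (- b) ⟩
    (a + b) + (- d + - b)   ≤⟨ +-monoˡ-≤ (- d + - b) a+b≤c+d ⟩
    (c + d) + (- d + - b)   ≡⟨ interchange c d (- d) (- b) ⟩
    (c - d) + (d - b)       ≡⟨ +-comm (c - d) (d - b) ⟩
    (d - b) + (c - d)       ≡⟨ [a-b]+[c-a]≡c-b d b c ⟩
    c - b                   ∎
    where open ≤-Reasoning

module SumProperties (R : OrderedCommRing) where
  open OrderedCommRing R
  open IsCommutativeRing isCommutativeRing using (+-assoc; +-comm; +-identityˡ)
  open OrderedCommRingProperties R

  sumOver-∷ : ∀ {n} b (T : Subset n) g →
              sumOver R (b ∷ T) g ≡ (if b then g fzero else 0#) + sumOver R T (g ∘ fsuc)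
  sumOver-∷ {n} b T g = cong ((if b then g fzero else 0#) +_) (begin
    foldr h 0# (tabulate fsuc)            ≡⟨ cong (foldr h 0#) (sym (map-tabulate id fsuc)) ⟩
    foldr h 0# (map fsuc (allFin n))      ≡⟨ foldr-map h fsuc 0# (allFin n) ⟩
    sumOver R T (g ∘ fsuc)                ∎)
    where
    open ≡-Reasoning
    h = λ e acc → (if lookup (b ∷ T) e then g e else 0#) + acc

  sumOver-mono : ∀ {n} (T : Subset n) {g h} → (∀ {e} → e ∈ T → g e ≤ h e) →
                 sumOver R T g ≤ sumOver R T h
  sumOver-mono [] _ = ≤-refl
  sumOver-mono (b ∷ T) {g} {h} g≤h = begin
    sumOver R (b ∷ T) g                                    ≡⟨ sumOver-∷ b T g ⟩
    (if b then g fzero else 0#) + sumOver R T (g ∘ fsuc)   ≤⟨ +-mono-≤ (head b g≤h) (sumOver-mono T (g≤h ∘ there)) ⟩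
    (if b then h fzero else 0#) + sumOver R T (h ∘ fsuc)   ≡⟨ sym (sumOver-∷ b T h) ⟩
    sumOver R (b ∷ T) h                                    ∎
    where
    open ≤-Reasoning
    head : ∀ b → (∀ {e} → e ∈ b ∷ T → g e ≤ h e) → (if b then g fzero else 0#) ≤ (if b then h fzero else 0#)
    head true  g≤h = g≤h here
    head false _   = ≤-refl

  sumOver-cong : ∀ {n} (T : Subset n) {g h} → (∀ {e} → e ∈ T → g e ≡ h e) →
                 sumOver R T g ≡ sumOver R T h
  sumOver-cong T g≡h = ≤-antisym (sumOver-mono T (≤-reflexive ∘ g≡h))
                                 (sumOver-mono T (≤-reflexive ∘ sym ∘ g≡h))

  sumOver-zero : ∀ {n} (T : Subset n) → sumOver R T (λ _ → 0#) ≡ 0#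
  sumOver-zero [] = refl
  sumOver-zero (b ∷ T) = begin
    sumOver R (b ∷ T) (λ _ → 0#)                         ≡⟨ sumOver-∷ b T (λ _ → 0#) ⟩
    (if b then 0# else 0#) + sumOver R T (λ _ → 0#)     ≡⟨ cong₂ _+_ (if-same b) (sumOver-zero T) ⟩
    0# + 0#                                              ≡⟨ +-identityˡ 0# ⟩
    0#                                                   ∎
    where
    open ≡-Reasoning
    if-same : ∀ b → (if b then 0# else 0#) ≡ 0#
    if-same true  = refl
    if-same false = refl

  sumOver-∅ : ∀ {n} g → sumOver R {n} ∅ g ≡ 0#
  sumOver-∅ {n} g = trans (sumOver-cong ∅ {g} (⊥-elim ∘ ∉⊥)) (sumOver-zero {n} ∅)

  sumOver-nonneg : ∀ {n} (T : Subset n) {g} → (∀ {e} → e ∈ T → 0# ≤ g e) → 0# ≤ sumOver R T g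
  sumOver-nonneg T 0≤g = subst (_≤ sumOver R T _) (sumOver-zero T) (sumOver-mono T 0≤g)

  sumOver-∪⁅⁆ : ∀ {n} (A : Subset n) {y} g → y ∉ A → sumOver R (A ∪ ⁅ y ⁆) g ≡ sumOver R A g + g y
  sumOver-∪⁅⁆ (true ∷ A) {fzero} g y∉A = ⊥-elim (y∉A here)
  sumOver-∪⁅⁆ (false ∷ A) {fzero} g _ = begin
    sumOver R (true ∷ (A ∪ ∅)) g                 ≡⟨ sumOver-∷ true (A ∪ ∅) g ⟩
    g fzero + sumOver R (A ∪ ∅) (g ∘ fsuc)       ≡⟨ cong (λ X → g fzero + sumOver R X (g ∘ fsuc)) (∪-identityʳ A) ⟩
    g fzero + sumOver R A (g ∘ fsuc)             ≡⟨ +-comm (g fzero) _ ⟩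
    sumOver R A (g ∘ fsuc) + g fzero             ≡⟨ cong (_+ g fzero) (sym (trans (sumOver-∷ false A g) (+-identityˡ _))) ⟩
    sumOver R (false ∷ A) g + g fzero            ∎
    where open ≡-Reasoning
  sumOver-∪⁅⁆ (a ∷ A) {fsuc y} g y∉A = begin
    sumOver R ((a ∨ false) ∷ (A ∪ ⁅ y ⁆)) g                         ≡⟨ sumOver-∷ (a ∨ false) (A ∪ ⁅ y ⁆) g ⟩
    (if a ∨ false then g fzero else 0#) + sumOver R (A ∪ ⁅ y ⁆) (g ∘ fsuc)
      ≡⟨ cong₂ (λ b s → (if b then g fzero else 0#) + s) (∨-identityʳ a) (sumOver-∪⁅⁆ A (g ∘ fsuc) (y∉A ∘ there)) ⟩
    (if a then g fzero else 0#) + (sumOver R A (g ∘ fsuc) + g (fsuc y))  ≡⟨ sym (+-assoc _ _ _) ⟩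
    ((if a then g fzero else 0#) + sumOver R A (g ∘ fsuc)) + g (fsuc y)  ≡⟨ cong (_+ g (fsuc y)) (sym (sumOver-∷ a A g)) ⟩
    sumOver R (a ∷ A) g + g (fsuc y)                                     ∎
    where open ≡-Reasoning

x∈p─q⇒x∉q : ∀ {n} (p q : Subset n) {x} → x ∈ p ─ q → x ∉ q
x∈p─q⇒x∉q (true  ∷ p) (false ∷ q) {fzero} here ()
x∈p─q⇒x∉q (_ ∷ p) (_ ∷ q) {fsuc x} (there x∈p─q) (there x∈q) = x∈p─q⇒x∉q p q x∈p─q x∈q

module _ {n : ℕ} where

  p⊆q⇒p∪q≡q : ∀ {p q : Subset n} → p ⊆ q → p ∪ q ≡ q
  p⊆q⇒p∪q≡q {p} {q} p⊆q = ⊆-antisym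
    (λ x∈p∪q → [ p⊆q , id ] (x∈p∪q⁻ p q x∈p∪q))
    (λ x∈q → x∈p∪q⁺ (inj₂ x∈q))

  p⊆q⇒p∩q≡p : ∀ {p q : Subset n} → p ⊆ q → p ∩ q ≡ p
  p⊆q⇒p∩q≡p {p} {q} p⊆q = ⊆-antisym (proj₁ ∘ x∈p∩q⁻ p q) (λ x∈p → x∈p∩q⁺ (x∈p , p⊆q x∈p))

  x∉p⇒⁅x⁆∩p≡∅ : ∀ {x} {p : Subset n} → x ∉ p → ⁅ x ⁆ ∩ p ≡ ∅
  x∉p⇒⁅x⁆∩p≡∅ {x} {p} x∉p = ⊆-antisym
    (λ y∈ → let (y∈⁅x⁆ , y∈p) = x∈p∩q⁻ ⁅ x ⁆ p y∈ in
            ⊥-elim (x∉p (subst (_∈ p) (x∈⁅y⁆⇒x≡y x y∈⁅x⁆) y∈p)))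
    (⊥-elim ∘ ∉⊥)

  ∩-monoˡ-⊆ : ∀ {p q} (r : Subset n) → p ⊆ q → p ∩ r ⊆ q ∩ r
  ∩-monoˡ-⊆ {p} r p⊆q x∈p∩r = let (x∈p , x∈r) = x∈p∩q⁻ p r x∈p∩r in x∈p∩q⁺ (p⊆q x∈p , x∈r)

-- before R π e unfolds to setOf R (preceding e π).
preceding : ∀ {n} → Fin n → List (Fin n) → List (Fin n)
preceding e = takeWhile (λ y → ¬? (y ≟ e))

module _ {n : ℕ} where

  ∉-preceding-self : ∀ (e : Fin n) l → e ∉ₗ preceding e l
  ∉-preceding-self e (y ∷ l) e∈ with y ≟ e | e∈
  ... | no y≢e | here e≡y  = y≢e (sym e≡y)
  ... | no _   | there e∈l = ∉-preceding-self e l e∈l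

  preceding-asym : ∀ (a b : Fin n) l → a ∈ₗ preceding b l → b ∉ₗ preceding a l
  preceding-asym a b (y ∷ l) a∈ b∈ with y ≟ b | y ≟ a | a∈ | b∈
  ... | no _   | no y≢a | here a≡y  | _         = y≢a (sym a≡y)
  ... | no y≢b | no _   | there _   | here b≡y  = y≢b (sym b≡y)
  ... | no _   | no _   | there a∈l | there b∈l = preceding-asym a b l a∈l b∈l

  preceding-++-∉ : ∀ {e : Fin n} xs ys → e ∉ₗ xs → preceding e (xs ++ ys) ≡ xs ++ preceding e ys
  preceding-++-∉ [] ys _ = refl
  preceding-++-∉ {e} (x ∷ xs) ys e∉ with x ≟ e
  ... | yes x≡e = ⊥-elim (e∉ (here (sym x≡e)))
  ... | no _    = cong (x ∷_) (preceding-++-∉ xs ys (e∉ ∘ there))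

  preceding-∷-self : ∀ (e : Fin n) ys → preceding e (e ∷ ys) ≡ []
  preceding-∷-self e ys with e ≟ e
  ... | yes _  = refl
  ... | no e≢e = ⊥-elim (e≢e refl)

  preceding-++-∈ : ∀ {e : Fin n} xs ys → e ∈ₗ xs → preceding e (xs ++ ys) ≡ preceding e xs
  preceding-++-∈ {e} (x ∷ xs) ys e∈ with x ≟ e | e∈
  ... | yes _   | _          = refl
  ... | no x≢e  | here e≡x   = ⊥-elim (x≢e (sym e≡x))
  ... | no _    | there e∈xs = cong (x ∷_) (preceding-++-∈ xs ys e∈xs)

  preceding-filter : ∀ {p} {P : Pred (Fin n) p} (P? : Decidable P) {e} → P e → ∀ l →
                     preceding e (filter P? l) ≡ filter P? (preceding e l)
  preceding-filter P? Pe [] = refl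
  preceding-filter P? {e} Pe (y ∷ l) with P? y
  ... | yes Py with y ≟ e
  ...   | yes _ = refl
  ...   | no _  = trans (cong (y ∷_) (preceding-filter P? Pe l)) (sym (filter-accept P? Py))
  preceding-filter P? {e} Pe (y ∷ l) | no ¬Py with y ≟ e
  ...   | yes y≡e = ⊥-elim (¬Py (subst _ (sym y≡e) Pe))
  ...   | no _    = trans (preceding-filter P? Pe l) (sym (filter-reject P? ¬Py))

Unique[xs++y∷zs]⇒y∉xs : ∀ {a} {A : Set a} xs {y : A} {zs} → Unique (xs ++ y ∷ zs) → y ∉ₗ xs
Unique[xs++y∷zs]⇒y∉xs (x ∷ xs) (x≢ ∷ _) (here refl) = All.lookup x≢ (∈-++⁺ʳ xs (here refl)) refl
Unique[xs++y∷zs]⇒y∉xs (x ∷ xs) (_ ∷ u)  (there y∈xs) = Unique[xs++y∷zs]⇒y∉xs xs u y∈xs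

module SetOfProperties (R : OrderedCommRing) {n : ℕ} where

  ∈-setOf⁺ : ∀ {x : Fin n} {l} → x ∈ₗ l → x ∈ setOf R l
  ∈-setOf⁺ {l = y ∷ _} (here refl) = x∈p∪q⁺ (inj₁ (x∈⁅x⁆ y))
  ∈-setOf⁺ {l = _ ∷ _} (there x∈l) = x∈p∪q⁺ (inj₂ (∈-setOf⁺ x∈l))

  ∈-setOf⁻ : ∀ {x : Fin n} l → x ∈ setOf R l → x ∈ₗ l
  ∈-setOf⁻ [] = ⊥-elim ∘ ∉⊥
  ∈-setOf⁻ (y ∷ l) x∈ with x∈p∪q⁻ ⁅ y ⁆ (setOf R l) x∈
  ... | inj₁ x∈⁅y⁆ = here (x∈⁅y⁆⇒x≡y y x∈⁅y⁆)
  ... | inj₂ x∈l   = there (∈-setOf⁻ l x∈l)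

  setOf-++ : ∀ (xs ys : List (Fin n)) → setOf R (xs ++ ys) ≡ setOf R xs ∪ setOf R ys
  setOf-++ []       ys = sym (∪-identityˡ (setOf R ys))
  setOf-++ (x ∷ xs) ys = trans (cong (⁅ x ⁆ ∪_) (setOf-++ xs ys)) (sym (∪-assoc ⁅ x ⁆ (setOf R xs) (setOf R ys)))

  setOf-∷ʳ : ∀ (xs : List (Fin n)) y → setOf R (xs ∷ʳ y) ≡ setOf R xs ∪ ⁅ y ⁆
  setOf-∷ʳ xs y = trans (setOf-++ xs (y ∷ [])) (cong (setOf R xs ∪_) (∪-identityʳ ⁅ y ⁆))

  ∩-setOf-∷ʳ : ∀ (T : Subset n) xs y → T ∩ setOf R (xs ∷ʳ y) ≡ (T ∩ setOf R xs) ∪ (T ∩ ⁅ y ⁆)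
  ∩-setOf-∷ʳ T xs y = trans (cong (T ∩_) (setOf-∷ʳ xs y)) (∩-distribˡ-∪ T (setOf R xs) ⁅ y ⁆)

  ∩-setOf-filter : ∀ (S : Subset n) l → S ∩ setOf R (filter (_∈? S) l) ≡ S ∩ setOf R l
  ∩-setOf-filter S l = ⊆-antisym
    (λ x∈ → let (x∈S , x∈F) = x∈p∩q⁻ S _ x∈ in
            x∈p∩q⁺ (x∈S , ∈-setOf⁺ (proj₁ (∈-filter⁻ (_∈? S) {xs = l} (∈-setOf⁻ _ x∈F)))))
    (λ x∈ → let (x∈S , x∈l) = x∈p∩q⁻ S _ x∈ in
            x∈p∩q⁺ (x∈S , ∈-setOf⁺ (∈-filter⁺ (_∈? S) (∈-setOf⁻ l x∈l) x∈S)))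

  ∉-before-self : ∀ π (e : Fin n) → e ∉ before R π e
  ∉-before-self π e = ∉-preceding-self e π ∘ ∈-setOf⁻ (preceding e π)

  before-asym : ∀ π (a b : Fin n) → a ∈ before R π b → b ∉ before R π a
  before-asym π a b a≺b b≺a =
    preceding-asym a b π (∈-setOf⁻ (preceding b π) a≺b) (∈-setOf⁻ (preceding a π) b≺a)

  before-split : ∀ xs (y : Fin n) zs → y ∉ₗ xs → before R (xs ++ y ∷ zs) y ≡ setOf R xs
  before-split xs y zs y∉xs = begin
    setOf R (preceding y (xs ++ y ∷ zs))   ≡⟨ cong (setOf R) (preceding-++-∉ xs (y ∷ zs) y∉xs) ⟩
    setOf R (xs ++ preceding y (y ∷ zs))   ≡⟨ cong (λ l → setOf R (xs ++ l)) (preceding-∷-self y zs) ⟩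
    setOf R (xs ++ [])                     ≡⟨ cong (setOf R) (++-identityʳ xs) ⟩
    setOf R xs                             ∎
    where open ≡-Reasoning

  before-++-∈ : ∀ {e : Fin n} xs ys → e ∈ₗ xs → before R (xs ++ ys) e ≡ before R xs e
  before-++-∈ xs ys e∈xs = cong (setOf R) (preceding-++-∈ xs ys e∈xs)

module PretendOrder (R : OrderedCommRing) {n : ℕ} where
  open SetOfProperties R

  ∈-pretend : ∀ {S₀ : Subset n} {πprev σ} → S₀ ⊆ setOf R πprev → (∀ x → x ∈ₗ σ) →
              ∀ x → x ∈ₗ pretend R S₀ πprev σ
  ∈-pretend {S₀} {πprev} {σ} S₀⊆πprev σ-complete x with x ∈? S₀
  ... | yes x∈S₀ = ∈-++⁺ˡ (∈-filter⁺ (_∈? S₀) (∈-setOf⁻ πprev (S₀⊆πprev x∈S₀)) x∈S₀)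
  ... | no  x∉S₀ = ∈-++⁺ʳ _ (∈-filter⁺ (λ y → ¬? (y ∈? S₀)) (σ-complete x) x∉S₀)

  pretend-unique : ∀ {S₀ : Subset n} {πprev σ} → Unique πprev → Unique σ → Unique (pretend R S₀ πprev σ)
  pretend-unique {S₀} {πprev} {σ} πprev-unique σ-unique =
    Unique.++⁺ (Unique.filter⁺ (_∈? S₀) πprev-unique) (Unique.filter⁺ (λ y → ¬? (y ∈? S₀)) σ-unique)
      λ (x∈F , x∈G) → proj₂ (∈-filter⁻ (λ y → ¬? (y ∈? S₀)) {xs = σ} x∈G)
                             (proj₂ (∈-filter⁻ (_∈? S₀) {xs = πprev} x∈F))

  ∩-before-pretend : ∀ {S₀ : Subset n} {πprev} σ {e} → e ∈ S₀ → e ∈ₗ πprev →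
                     S₀ ∩ before R (pretend R S₀ πprev σ) e ≡ S₀ ∩ before R πprev e
  ∩-before-pretend {S₀} {πprev} σ {e} e∈S₀ e∈πprev = begin
    S₀ ∩ before R (F ++ G) e                                   ≡⟨ cong (S₀ ∩_) (before-++-∈ F G (∈-filter⁺ (_∈? S₀) e∈πprev e∈S₀)) ⟩
    S₀ ∩ setOf R (preceding e (filter (_∈? S₀) πprev))         ≡⟨ cong (λ l → S₀ ∩ setOf R l) (preceding-filter (_∈? S₀) e∈S₀ πprev) ⟩
    S₀ ∩ setOf R (filter (_∈? S₀) (preceding e πprev))         ≡⟨ ∩-setOf-filter S₀ (preceding e πprev) ⟩
    S₀ ∩ before R πprev e                                      ∎
    where
    open ≡-Reasoning
    F = filter (_∈? S₀) πprev
    G = filter (λ y → ¬? (y ∈? S₀)) σ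

  before-pretend-arrival : ∀ {S₀ : Subset n} πprev {seen x} xs → S₀ ⊆ setOf R πprev → x ∉ S₀ → x ∉ₗ seen →
                           S₀ ∪ setOf R seen ⊆ before R (pretend R S₀ πprev (seen ++ x ∷ xs)) x
  before-pretend-arrival {S₀} πprev {seen} {x} xs S₀⊆πprev x∉S₀ x∉seen =
    subst (S₀ ∪ setOf R seen ⊆_) (sym before≡) earlier
    where
    open ≡-Reasoning
    Q? = λ y → ¬? (y ∈? S₀)
    F = filter (_∈? S₀) πprev
    x∉F++seen : x ∉ₗ F ++ filter Q? seen
    x∉F++seen x∈ with ∈-++⁻ F x∈
    ... | inj₁ x∈F    = x∉S₀ (proj₂ (∈-filter⁻ (_∈? S₀) {xs = πprev} x∈F))
    ... | inj₂ x∈seen = x∉seen (proj₁ (∈-filter⁻ Q? {xs = seen} x∈seen))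
    before≡ : before R (pretend R S₀ πprev (seen ++ x ∷ xs)) x ≡ setOf R (F ++ filter Q? seen)
    before≡ = begin
      before R (F ++ filter Q? (seen ++ x ∷ xs)) x                ≡⟨ cong (λ l → before R (F ++ l) x) (filter-++ Q? seen (x ∷ xs)) ⟩
      before R (F ++ filter Q? seen ++ filter Q? (x ∷ xs)) x      ≡⟨ cong (λ l → before R (F ++ filter Q? seen ++ l) x) (filter-accept Q? x∉S₀) ⟩
      before R (F ++ filter Q? seen ++ x ∷ filter Q? xs) x        ≡⟨ cong (λ l → before R l x) (sym (++-assoc F (filter Q? seen) _)) ⟩
      before R ((F ++ filter Q? seen) ++ x ∷ filter Q? xs) x      ≡⟨ before-split (F ++ filter Q? seen) x _ x∉F++seen ⟩
      setOf R (F ++ filter Q? seen)                               ∎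
    earlier : S₀ ∪ setOf R seen ⊆ setOf R (F ++ filter Q? seen)
    earlier {e} e∈ with e ∈? S₀ | x∈p∪q⁻ S₀ (setOf R seen) e∈
    ... | yes e∈S₀ | _ = ∈-setOf⁺ (∈-++⁺ˡ (∈-filter⁺ (_∈? S₀) (∈-setOf⁻ πprev (S₀⊆πprev e∈S₀)) e∈S₀))
    ... | no e∉S₀ | inj₁ e∈S₀   = ⊥-elim (e∉S₀ e∈S₀)
    ... | no e∉S₀ | inj₂ e∈seen = ∈-setOf⁺ (∈-++⁺ʳ F (∈-filter⁺ Q? (∈-setOf⁻ seen e∈seen) e∉S₀))

module Telescoping (R : OrderedCommRing) {n : ℕ} (f : Subset n → OrderedCommRing.Carrier R) where
  open OrderedCommRing R
  open IsCommutativeRing isCommutativeRing using (-‿inverseʳ)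
  open OrderedCommRingProperties R
  open SumProperties R
  open SetOfProperties R

  -- Walk through π, keeping Σ over the already visited part of T equal to f(B ∪ visited) − f(B).
  sumOver-marg-telescopes : ∀ {π} → Unique π → (∀ x → x ∈ₗ π) → ∀ B T →
    sumOver R T (λ t → marg R f ⁅ t ⁆ (B ∪ (T ∩ before R π t))) ≡ f (B ∪ T) - f B
  sumOver-marg-telescopes {π} π-unique π-complete B T =
    visit [] π refl (subst Telescoped (sym (∩-zeroʳ T)) visited-∅)
    where
    g : Fin n → Carrier
    g t = marg R f ⁅ t ⁆ (B ∪ (T ∩ before R π t))

    Telescoped : Subset n → Set
    Telescoped A = sumOver R A g ≡ f (B ∪ A) - f B

    visited-∅ : Telescoped ∅
    visited-∅ = begin
      sumOver R ∅ g     ≡⟨ sumOver-∅ g ⟩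
      0#                ≡⟨ sym (-‿inverseʳ (f B)) ⟩
      f B - f B         ≡⟨ cong (λ X → f X - f B) (sym (∪-identityʳ B)) ⟩
      f (B ∪ ∅) - f B   ∎
      where open ≡-Reasoning

    visit-next : ∀ xs y zs → π ≡ xs ++ y ∷ zs →
                 Telescoped (T ∩ setOf R xs) → Telescoped (T ∩ setOf R (xs ∷ʳ y))
    visit-next xs y zs π≡ tel with y ∈? T
    ... | no y∉T = subst Telescoped (sym T∩xsy≡) tel
      where
      T∩xsy≡ : T ∩ setOf R (xs ∷ʳ y) ≡ T ∩ setOf R xs
      T∩xsy≡ = begin
        T ∩ setOf R (xs ∷ʳ y)            ≡⟨ ∩-setOf-∷ʳ T xs y ⟩
        (T ∩ setOf R xs) ∪ (T ∩ ⁅ y ⁆)   ≡⟨ cong ((T ∩ setOf R xs) ∪_) (trans (∩-comm T ⁅ y ⁆) (x∉p⇒⁅x⁆∩p≡∅ y∉T)) ⟩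
        (T ∩ setOf R xs) ∪ ∅             ≡⟨ ∪-identityʳ _ ⟩
        T ∩ setOf R xs                   ∎
        where open ≡-Reasoning
    ... | yes y∈T = begin
      sumOver R (T ∩ setOf R (xs ∷ʳ y)) g              ≡⟨ cong (λ X → sumOver R X g) T∩xsy≡ ⟩
      sumOver R (A ∪ ⁅ y ⁆) g                          ≡⟨ sumOver-∪⁅⁆ A g y∉A ⟩
      sumOver R A g + g y                              ≡⟨ cong₂ _+_ tel (cong (λ X → marg R f ⁅ y ⁆ (B ∪ (T ∩ X))) before-y) ⟩
      (f (B ∪ A) - f B) + (f (⁅ y ⁆ ∪ (B ∪ A)) - f (B ∪ A))   ≡⟨ [a-b]+[c-a]≡c-b _ _ _ ⟩
      f (⁅ y ⁆ ∪ (B ∪ A)) - f B                        ≡⟨ cong (λ X → f X - f B) (trans (∪-comm ⁅ y ⁆ (B ∪ A)) (∪-assoc B A ⁅ y ⁆)) ⟩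
      f (B ∪ (A ∪ ⁅ y ⁆)) - f B                        ≡⟨ cong (λ X → f (B ∪ X) - f B) (sym T∩xsy≡) ⟩
      f (B ∪ (T ∩ setOf R (xs ∷ʳ y))) - f B            ∎
      where
      open ≡-Reasoning
      A = T ∩ setOf R xs
      y∉xs : y ∉ₗ xs
      y∉xs = Unique[xs++y∷zs]⇒y∉xs xs (subst Unique π≡ π-unique)
      y∉A : y ∉ A
      y∉A = y∉xs ∘ ∈-setOf⁻ xs ∘ proj₂ ∘ x∈p∩q⁻ T (setOf R xs)
      before-y : before R π y ≡ setOf R xs
      before-y = trans (cong (λ l → before R l y) π≡) (before-split xs y zs y∉xs)
      ⁅y⁆⊆T : ⁅ y ⁆ ⊆ T
      ⁅y⁆⊆T z∈⁅y⁆ = subst (_∈ T) (sym (x∈⁅y⁆⇒x≡y y z∈⁅y⁆)) y∈T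
      T∩xsy≡ : T ∩ setOf R (xs ∷ʳ y) ≡ A ∪ ⁅ y ⁆
      T∩xsy≡ = trans (∩-setOf-∷ʳ T xs y) (cong (A ∪_) (trans (∩-comm T ⁅ y ⁆) (p⊆q⇒p∩q≡p ⁅y⁆⊆T)))
    visit : ∀ xs zs → π ≡ xs ++ zs → Telescoped (T ∩ setOf R xs) → Telescoped T
    visit xs [] π≡ tel = subst Telescoped (p⊆q⇒p∩q≡p T⊆xs) tel
      where
      T⊆xs : T ⊆ setOf R xs
      T⊆xs {x} _ = ∈-setOf⁺ (subst (x ∈ₗ_) (trans π≡ (++-identityʳ xs)) (π-complete x))
    visit xs (y ∷ zs) π≡ tel =
      visit (xs ∷ʳ y) zs (trans π≡ (sym (++-assoc xs (y ∷ []) zs))) (visit-next xs y zs π≡ tel)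

module Submodularity (R : OrderedCommRing) {n : ℕ} (f : Subset n → OrderedCommRing.Carrier R)
                     (sub : Submodular R f) where
  open OrderedCommRing R
  open OrderedCommRingProperties R
  open SumProperties R
  open SetOfProperties R
  open Telescoping R f

  marg-antitone : ∀ {A B : Subset n} {x} → A ⊆ B → x ∉ B → marg R f ⁅ x ⁆ B ≤ marg R f ⁅ x ⁆ A
  marg-antitone {A} {B} {x} A⊆B x∉B =
    a+b≤c+d⇒a-d≤c-b (subst₂ (λ X Y → f X + f Y ≤ f (⁅ x ⁆ ∪ A) + f B) ∪≡ ∩≡ (sub (⁅ x ⁆ ∪ A) B))
    where
    open ≡-Reasoning
    ∪≡ : (⁅ x ⁆ ∪ A) ∪ B ≡ ⁅ x ⁆ ∪ B
    ∪≡ = trans (∪-assoc ⁅ x ⁆ A B) (cong (⁅ x ⁆ ∪_) (p⊆q⇒p∪q≡q A⊆B))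
    ∩≡ : (⁅ x ⁆ ∪ A) ∩ B ≡ A
    ∩≡ = begin
      (⁅ x ⁆ ∪ A) ∩ B          ≡⟨ ∩-distribʳ-∪ B ⁅ x ⁆ A ⟩
      (⁅ x ⁆ ∩ B) ∪ (A ∩ B)    ≡⟨ cong₂ _∪_ (x∉p⇒⁅x⁆∩p≡∅ x∉B) (p⊆q⇒p∩q≡p A⊆B) ⟩
      ∅ ∪ A                    ≡⟨ ∪-identityˡ A ⟩
      A                        ∎

  module _ (π : List (Fin n)) where

    ν-antitone : ∀ {T U} → T ⊆ U → ∀ e → ν R f π e U ≤ ν R f π e T
    ν-antitone {T} {U} T⊆U e = marg-antitone (∩-monoˡ-⊆ (before R π e) T⊆U) (∉-before-self π e ∘ proj₂ ∘ x∈p∩q⁻ U _)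

    sumOver-ν-telescopes : Unique π → (∀ x → x ∈ₗ π) → ∀ T → sumOver R T (λ e → ν R f π e T) ≡ f T - f ∅
    sumOver-ν-telescopes π-unique π-complete T = begin
      sumOver R T (λ e → ν R f π e T)                               ≡⟨ sumOver-cong T (λ {e} _ → cong (marg R f ⁅ e ⁆) (sym (∪-identityˡ _))) ⟩
      sumOver R T (λ e → marg R f ⁅ e ⁆ (∅ ∪ (T ∩ before R π e)))   ≡⟨ sumOver-marg-telescopes π-unique π-complete ∅ T ⟩
      f (∅ ∪ T) - f ∅                                               ≡⟨ cong (λ X → f X - f ∅) (∪-identityˡ T) ⟩
      f T - f ∅                                                     ∎
      where open ≡-Reasoning

    marg-≤-sumOver-ν : Unique π → (∀ x → x ∈ₗ π) → ∀ T U → marg R f T (U ─ T) ≤ sumOver R T (λ t → ν R f π t U)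
    marg-≤-sumOver-ν π-unique π-complete T U = begin
      f (T ∪ (U ─ T)) - f (U ─ T)                                        ≡⟨ cong (λ X → f X - f (U ─ T)) (∪-comm T (U ─ T)) ⟩
      f ((U ─ T) ∪ T) - f (U ─ T)                                        ≡⟨ sym (sumOver-marg-telescopes π-unique π-complete (U ─ T) T) ⟩
      sumOver R T (λ t → marg R f ⁅ t ⁆ ((U ─ T) ∪ (T ∩ before R π t)))  ≤⟨ sumOver-mono T (λ t∈T → marg-antitone (U∩before⊆ _) (t∉ t∈T)) ⟩
      sumOver R T (λ t → ν R f π t U)                                    ∎
      where
      open ≤-Reasoning
      U∩before⊆ : ∀ t → U ∩ before R π t ⊆ (U ─ T) ∪ (T ∩ before R π t)
      U∩before⊆ t {y} y∈ with x∈p∩q⁻ U _ y∈ | y ∈? T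
      ... | y∈U , y≺t | yes y∈T = x∈p∪q⁺ (inj₂ (x∈p∩q⁺ (y∈T , y≺t)))
      ... | y∈U , _   | no y∉T  = x∈p∪q⁺ (inj₁ (x∈p∧x∉q⇒x∈p─q y∈U y∉T))
      t∉ : ∀ {t} → t ∈ T → t ∉ (U ─ T) ∪ (T ∩ before R π t)
      t∉ {t} t∈T t∈ with x∈p∪q⁻ (U ─ T) _ t∈
      ... | inj₁ t∈U─T = x∈p─q⇒x∉q U T t∈U─T t∈T
      ... | inj₂ t∈T≺t = ∉-before-self π t (proj₂ (x∈p∩q⁻ T _ t∈T≺t))

    ν-≤-after-insert : ∀ {S S' : Subset n} {x e} → S ⊆ before R π x → S' ⊆ S ∪ ⁅ x ⁆ → e ∈ S →
                       ν R f π e S ≤ ν R f π e S'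
    ν-≤-after-insert {S} {S'} {x} {e} S≺x S'⊆S∪x e∈S =
      marg-antitone S'∩≺e⊆S∩≺e (∉-before-self π e ∘ proj₂ ∘ x∈p∩q⁻ S _)
      where
      S'∩≺e⊆S∩≺e : S' ∩ before R π e ⊆ S ∩ before R π e
      S'∩≺e⊆S∩≺e {y} y∈ with x∈p∩q⁻ S' _ y∈
      ... | y∈S' , y≺e with x∈p∪q⁻ S ⁅ x ⁆ (S'⊆S∪x y∈S')
      ...   | inj₁ y∈S   = x∈p∩q⁺ (y∈S , y≺e)
      ...   | inj₂ y∈⁅x⁆ = ⊥-elim (before-asym π e x (S≺x e∈S) (subst (_∈ before R π e) (x∈⁅y⁆⇒x≡y x y∈⁅x⁆) y≺e))

    marg-≤-ν-inserted : ∀ {S S' : Subset n} {x} → x ∉ S → S' ⊆ S ∪ ⁅ x ⁆ → marg R f ⁅ x ⁆ S ≤ ν R f π x S'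
    marg-≤-ν-inserted {S} {S'} {x} x∉S S'⊆S∪x = marg-antitone S'∩≺x⊆S x∉S
      where
      S'∩≺x⊆S : S' ∩ before R π x ⊆ S
      S'∩≺x⊆S {y} y∈ with x∈p∩q⁻ S' _ y∈
      ... | y∈S' , y≺x with x∈p∪q⁻ S ⁅ x ⁆ (S'⊆S∪x y∈S')
      ...   | inj₁ y∈S   = y∈S
      ...   | inj₂ y∈⁅x⁆ = ⊥-elim (∉-before-self π x (subst (_∈ before R π x) (x∈⁅y⁆⇒x≡y x y∈⁅x⁆) y≺x))

module _ (R : OrderedCommRing) {n p : ℕ} (f : Subset n → OrderedCommRing.Carrier R)
         (sub : Submodular R f) (𝓜 : Matchoid n p) where
  open OrderedCommRing R renaming (_<_ to _<ᴿ_)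
  open OrderedCommRingProperties R
  open SumProperties R
  open SetOfProperties R
  open PretendOrder R
  open Submodularity R f sub

  IsExchange⇒⊆ : ∀ {π x S C} → IsExchange R f 𝓜 π x S C → C ⊆ S
  IsExchange⇒⊆ {S = S} ex {c} c∈C with Equivalence.to (IsExchange.C-spec ex c) c∈C
  ... | ℓ , pick≡ = proj₁ (x∈p∩q⁻ S _ (proj₁ (proj₁ (proj₂ (IsExchange.pick-just ex ℓ c pick≡)))))

  module StreamingPass (α β : Carrier) (0≤α : 0# ≤ α) (0≤1+β : 0# ≤ 1# + β)
                       (S₀ : Subset n) (πprev σ : List (Fin n)) (σ-unique : Unique σ)
                       (S₀⊆πprev : S₀ ⊆ setOf R πprev) (α≤ν₀ : ∀ {e} → e ∈ S₀ → α ≤ ν R f πprev e S₀) where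

    π : List (Fin n)
    π = pretend R S₀ πprev σ

    record Invariant (rest : List (Fin n)) (S : Subset n) : Set where
      field
        seen          : List (Fin n)
        σ≡seen++rest  : σ ≡ seen ++ rest
        S⊆S₀∪seen     : S ⊆ S₀ ∪ setOf R seen
        α≤ν           : ∀ {e} → e ∈ S → α ≤ ν R f π e S

    -- Evicted elements have ν ≥ α ≥ 0, so the acceptance test forces f(x | S) ≥ α.
    α≤marg-accepted : ∀ {x S C} → IsExchange R f 𝓜 π x S C → (∀ {e} → e ∈ S → α ≤ ν R f π e S) →
                      α + (1# + β) * sumOver R C (λ c → ν R f π c S) ≤ marg R f ⁅ x ⁆ S →
                      α ≤ marg R f ⁅ x ⁆ S
    α≤marg-accepted {C = C} ex α≤ν accepted =
      ≤-trans (x≤x+y (*-nonneg 0≤1+β (sumOver-nonneg C (λ c∈C → ≤-trans 0≤α (α≤ν (IsExchange⇒⊆ ex c∈C))))))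
              accepted

    S₀∪seen-grows : ∀ seen x → S₀ ∪ setOf R seen ⊆ S₀ ∪ setOf R (seen ∷ʳ x)
    S₀∪seen-grows seen x y∈ with x∈p∪q⁻ S₀ _ y∈
    ... | inj₁ y∈S₀   = x∈p∪q⁺ (inj₁ y∈S₀)
    ... | inj₂ y∈seen = x∈p∪q⁺ (inj₂ (∈-setOf⁺ (∈-++⁺ˡ (∈-setOf⁻ seen y∈seen))))

    invariant-skip : ∀ {x xs S} → Invariant (x ∷ xs) S → Invariant xs S
    invariant-skip {x} {xs} inv = record
      { seen         = seen ∷ʳ x
      ; σ≡seen++rest = trans σ≡seen++rest (sym (++-assoc seen (x ∷ []) xs))
      ; S⊆S₀∪seen    = S₀∪seen-grows seen x ∘ S⊆S₀∪seen
      ; α≤ν          = α≤ν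
      }
      where open Invariant inv

    invariant-accept : ∀ {x xs S C} → Invariant (x ∷ xs) S → x ∉ S₀ → IsExchange R f 𝓜 π x S C →
                       α + (1# + β) * sumOver R C (λ c → ν R f π c S) ≤ marg R f ⁅ x ⁆ S →
                       Invariant xs ((S ─ C) ∪ ⁅ x ⁆)
    invariant-accept {x} {xs} {S} {C} inv x∉S₀ ex accepted = record
      { seen         = seen ∷ʳ x
      ; σ≡seen++rest = Invariant.σ≡seen++rest (invariant-skip inv)
      ; S⊆S₀∪seen    = S'⊆S₀∪seen
      ; α≤ν          = α≤ν'
      }
      where
      open Invariant inv
      S' = (S ─ C) ∪ ⁅ x ⁆
      x∉seen : x ∉ₗ seen
      x∉seen = Unique[xs++y∷zs]⇒y∉xs seen (subst Unique σ≡seen++rest σ-unique)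
      x∉S : x ∉ S
      x∉S = [ x∉S₀ , x∉seen ∘ ∈-setOf⁻ seen ] ∘ x∈p∪q⁻ S₀ _ ∘ S⊆S₀∪seen
      S≺x : S ⊆ before R π x
      S≺x = subst (λ σ' → S₀ ∪ setOf R seen ⊆ before R (pretend R S₀ πprev σ') x) (sym σ≡seen++rest)
                  (before-pretend-arrival πprev xs S₀⊆πprev x∉S₀ x∉seen)
            ∘ S⊆S₀∪seen
      S'⊆S∪x : S' ⊆ S ∪ ⁅ x ⁆
      S'⊆S∪x = [ x∈p∪q⁺ ∘ inj₁ ∘ p─q⊆p S C , x∈p∪q⁺ ∘ inj₂ ] ∘ x∈p∪q⁻ (S ─ C) ⁅ x ⁆
      S'⊆S₀∪seen : S' ⊆ S₀ ∪ setOf R (seen ∷ʳ x)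
      S'⊆S₀∪seen y∈S' with x∈p∪q⁻ S ⁅ x ⁆ (S'⊆S∪x y∈S')
      ... | inj₁ y∈S   = S₀∪seen-grows seen x (S⊆S₀∪seen y∈S)
      ... | inj₂ y∈⁅x⁆ = x∈p∪q⁺ (inj₂ (∈-setOf⁺ (∈-++⁺ʳ seen (here (x∈⁅y⁆⇒x≡y x y∈⁅x⁆)))))
      α≤ν' : ∀ {e} → e ∈ S' → α ≤ ν R f π e S'
      α≤ν' {e} e∈S' with x∈p∪q⁻ S ⁅ x ⁆ (S'⊆S∪x e∈S')
      ... | inj₁ e∈S   = ≤-trans (α≤ν e∈S) (ν-≤-after-insert π S≺x S'⊆S∪x e∈S)
      ... | inj₂ e∈⁅x⁆ rewrite x∈⁅y⁆⇒x≡y x e∈⁅x⁆ =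
        ≤-trans (α≤marg-accepted ex α≤ν accepted) (marg-≤-ν-inserted π x∉S S'⊆S∪x)

    invariant-step : ∀ {x xs S S'} → Invariant (x ∷ xs) S → Step R f 𝓜 α β S₀ π x S S' → Invariant xs S'
    invariant-step inv (discard _)                = invariant-skip inv
    invariant-step inv (reject _ _ _)             = invariant-skip inv
    invariant-step inv (accept x∉S₀ ex accepted) = invariant-accept inv x∉S₀ ex accepted

    invariant : ∀ {rest S} → Trace R f 𝓜 α β S₀ π σ rest S → Invariant rest S
    invariant start = record
      { seen         = []
      ; σ≡seen++rest = refl
      ; S⊆S₀∪seen    = x∈p∪q⁺ ∘ inj₁
      ; α≤ν          = λ {e} e∈S₀ →
          subst (α ≤_) (cong (marg R f ⁅ e ⁆) (sym (∩-before-pretend σ e∈S₀ (∈-setOf⁻ πprev (S₀⊆πprev e∈S₀)))))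
                (α≤ν₀ e∈S₀)
      }
    invariant (step trace s) = invariant-step (invariant trace) s

  record Settled (α : Carrier) (S : Subset n) (π : List (Fin n)) : Set where
    field
      S⊆π      : S ⊆ setOf R π
      unique   : Unique π
      α≤ν      : ∀ {e} → e ∈ S → α ≤ ν R f π e S

  multipass-settled : ∀ {α} → 0# ≤ α → (β : ℕ → Carrier) (σ : ℕ → List (Fin n)) → (∀ j → IsStream (σ j)) →
                      ∀ {i S π} → (∀ j → j < i → 0# <ᴿ β j) → MultipassState R f 𝓜 α β σ i S π → Settled α S π
  multipass-settled 0≤α β σ σ-stream 0<β init = record
    { S⊆π = ⊥-elim ∘ ∉⊥ ; unique = [] ; α≤ν = ⊥-elim ∘ ∉⊥ }
  multipass-settled {α} 0≤α β σ σ-stream {suc i} 0<β (next {S = S} {π = πprev} state trace) = record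
    { S⊆π      = λ {x} _ → ∈-setOf⁺ (∈-pretend {πprev = πprev} S⊆π (proj₂ (σ-stream i)) x)
    ; unique   = pretend-unique unique (proj₁ (σ-stream i))
    ; α≤ν      = Invariant.α≤ν (invariant trace)
    }
    where
    open Settled (multipass-settled 0≤α β σ σ-stream (λ j j<i → 0<β j (m<n⇒m<1+n j<i)) state)
    open StreamingPass α (β i) 0≤α (0<x⇒0≤1+x (0<β i (n<1+n i))) S πprev (σ i) (proj₁ (σ-stream i)) S⊆π α≤ν

lemma1 : (R : OrderedCommRing) → (n p : ℕ) →
    (f : Subset n → OrderedCommRing.Carrier R) →
    NonNegative R f → Submodular R f →
    (𝓜 : Matchoid n p) →
    (α : OrderedCommRing.Carrier R) → OrderedCommRing._≤_ R (OrderedCommRing.0# R) α →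
    (d : ℕ) → (β : ℕ → OrderedCommRing.Carrier R) →
    (∀ j → j < d → OrderedCommRing._<_ R (OrderedCommRing.0# R) (β j)) →
    (σ : ℕ → List (Fin n)) → (∀ j → IsStream (σ j)) →
    (i : ℕ) → i < d →
    (Sinit : Subset n) → (πprev : List (Fin n)) →
    MultipassState R f 𝓜 α β σ i Sinit πprev →
    (∀ (T U : Subset n) → T ⊆ U →
      (sumOver R T (λ e → ν R f (pretend R Sinit πprev (σ i)) e T)
        ≡ OrderedCommRing._-_ R (f T) (f ∅))
      × (∀ e → e ∈ T →
          OrderedCommRing._≤_ R (ν R f (pretend R Sinit πprev (σ i)) e U)
                                (ν R f (pretend R Sinit πprev (σ i)) e T))
      × OrderedCommRing._≤_ R (marg R f T (U ─ T))
          (sumOver R T (λ t → ν R f (pretend R Sinit πprev (σ i)) t U)))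
    × (∀ (rest : List (Fin n)) (S : Subset n) →
        Trace R f 𝓜 α (β i) Sinit (pretend R Sinit πprev (σ i)) (σ i) rest S →
        ∀ e → e ∈ S →
          OrderedCommRing._≤_ R α (ν R f (pretend R Sinit πprev (σ i)) e S))
lemma1 R n p f _ sub 𝓜 α 0≤α d β 0<β σ σ-stream i i<d Sinit πprev state =
  (λ T U T⊆U → sumOver-ν-telescopes π π-unique π-complete T
             , (λ e _ → ν-antitone π T⊆U e)
             , marg-≤-sumOver-ν π π-unique π-complete T U)
  , λ _ _ trace _ e∈S → Invariant.α≤ν (invariant trace) e∈S
  where
  open OrderedCommRingProperties R using (0<x⇒0≤1+x)
  open PretendOrder R
  open Submodularity R f sub
  open Settled (multipass-settled R f sub 𝓜 0≤α β σ σ-stream (λ j j<i → 0<β j (<-trans j<i i<d)) state)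
  open StreamingPass R f sub 𝓜 α (β i) 0≤α (0<x⇒0≤1+x (0<β i i<d)) Sinit πprev (σ i) (proj₁ (σ-stream i)) S⊆π α≤ν
  π-complete : ∀ x → x ∈ₗ π
  π-complete = ∈-pretend {πprev = πprev} S⊆π (proj₂ (σ-stream i))
  π-unique : Unique π
  π-unique = pretend-unique {πprev = πprev} unique (proj₁ (σ-stream i))
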